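{- Let $a,t,s$ be integers with $t\ge a\ge 2$ and $s\ge 2$. Then $R^{a+1}\big(SK^{(a)}_t,TK_s\big)\le \binom{t}{2}+(s-1)t$.
   Context: $K^{(a)}_n$ is the complete $a$-uniform hypergraph on $n$ vertices and $K_n$ the complete graph. For an $a$-uniform hypergraph $\mathcal{H}$, its $(a+1)$-suspension $S\mathcal{H}$ is obtained by adding one fixed new vertex $u$ to every hyperedge: $V(S\mathcal{H})=V(\mathcal{H})\cup\{u\}$, $E(S\mathcal{H})=\{e\cup\{u\}:e\in E(\mathcal{H})\}$. For a hypergraph $\mathcal{H}'$ and $S\subseteq V(\mathcal{H}')$, $\mathrm{Tr}(\mathcal{H}',S)$ is the hypergraph on $S$ with hyperedges $\{h\cap S:h\in E(\mathcal{H}')\}$; for a graph $G$, $TG$ is the set of $(a+1)$-uniform hypergraphs $\mathcal{H}'$ with $V(G)\subseteq V(\mathcal{H}')$ and $\mathrm{Tr}(\mathcal{H}',V(G))=G$. For collections $\mathcal{F}_1,\mathcal{F}_2$ of $r$-uniform hypergraphs, $R^r(\mathcal{F}_1,\mathcal{F}_2)$ is the least $N$ such that every 2-coloring of the hyperedges of the complete $r$-uniform hypergraph on $N$ vertices contains a subhypergraph of the first color isomorphic to a member of $\mathcal{F}_1$ or one of the second color isomorphic to a member of $\mathcal{F}_2$. Here $r=a+1$. -}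

module Defs where

open import Data.Nat using (ℕ; zero; suc; _+_; _*_; _∸_)
open import Data.Nat.Combinatorics using (_C_)
open import Data.Bool using (Bool; true; false; if_then_else_)
open import Data.Fin using (Fin; zero; suc)
open import Data.Fin.Subset using (Subset; ⁅_⁆; _∪_; ∣_∣; inside; outside) renaming (⊥ to ∅)
open import Data.Vec using (Vec; []; _∷_; tabulate; lookup)
open import Data.Product using (Σ; ∃; _×_; _,_)
open import Data.Sum using (_⊎_)
open import Function using (_∘_)
open import Function.Definitions using (Injective)
open import Relation.Binary.PropositionalEquality using (_≡_)

Hypergraph : ℕ → Set₁
Hypergraph m = Subset m → Set

Uniform : ℕ → {m : ℕ} → Hypergraph m → Set
Uniform r H = ∀ e → H e → ∣ e ∣ ≡ r

Complete : (a m : ℕ) → Hypergraph m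
Complete a m e = ∣ e ∣ ≡ a

-- Suspension: new vertex u = zero of Fin (suc m) added to every hyperedge.
Suspension : {m : ℕ} → Hypergraph m → Hypergraph (suc m)
Suspension H (x ∷ e) = (x ≡ inside) × H e

img : {m N : ℕ} → (Fin m → Fin N) → Subset m → Subset N
img {zero}  f []      = ∅
img {suc m} f (x ∷ e) = (if x then ⁅ f zero ⁆ else ∅) ∪ img (f ∘ suc) e

-- Trace on the image of ι : Fin s → Fin m, pulled back to Fin s: h ∩ ι(Fin s).
traceOn : {s m : ℕ} → (Fin s → Fin m) → Subset m → Subset s
traceOn ι h = tabulate (λ i → lookup h (ι i))

-- Members of TK_s (as (a+1)-uniform hypergraphs H' with an injective copy ι
-- of V(K_s) inside V(H') = Fin m): Tr(H', V(K_s)) = K_s, i.e. the set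
-- {h ∩ V(K_s) : h ∈ E(H')} equals the set of 2-subsets of V(K_s).
InTK : (a s : ℕ) {m : ℕ} → Hypergraph m → Set
InTK a s {m} H =
  Uniform (suc a) H ×
  Σ (Fin s → Fin m) λ ι → Injective _≡_ _≡_ ι ×
    ((∀ h → H h → ∣ traceOn ι h ∣ ≡ 2) ×
     (∀ p → ∣ p ∣ ≡ 2 → Σ (Subset m) λ h → H h × traceOn ι h ≡ p))

-- A 2-colouring of the hyperedges of the complete r-uniform hypergraph on Fin N
-- (only its values on r-subsets matter).
Colouring : ℕ → Set
Colouring N = Subset N → Bool

Contains : {N m : ℕ} → Colouring N → Bool → Hypergraph m → Set
Contains {N} {m} c col H =
  Σ (Fin m → Fin N) λ f → Injective _≡_ _≡_ f × (∀ e → H e → c (img f e) ≡ col)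

-- Ramsey property at N for r = a+1:
-- every colouring yields a colour-true copy of S K^(a)_t or a colour-false
-- copy of some member of TK_s.
RamseyArrow : (a t s N : ℕ) → Set₁
RamseyArrow a t s N =
  (c : Colouring N) →
    Contains c true (Suspension (Complete a t)) ⊎
    (∃ λ m → Σ (Hypergraph m) λ H → InTK a s H × Contains c false H)

-- Let n(t, s) = 1 + (s − 1)t. Among n(t, s) vertices, induction on t yields either a blue TK_s
-- or a red S K_{t−1}; delete its t vertices, leaving at least n(t, s − 1). If some remaining
-- vertex x lies in no blue hyperedge formed by the apex, x and a − 1 leaves, then x is a new leaf
-- of a red S K_t. Otherwise induction on s gives a red S K_t or a blue TK_{s−1} among the
-- remaining vertices, and adding the apex makes the latter a blue TK_s: the blue hyperedge through
-- the apex and a branch vertex x meets the branch vertices only in the apex and x, since its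
-- other vertices are the deleted leaves. So the bound is even 1 + (s − 1)t ≤ C(t, 2) + (s − 1)t.

module Submission where

open import Defs
open import Data.Nat using (ℕ; _+_; _*_; _∸_; _≤_)
open import Data.Nat.Combinatorics using (_C_)

open import Data.Nat using (zero; suc; _<_; z≤n; s≤s; _≟_)
open import Data.Nat.Properties
  using ( ≤-trans; ≤-reflexive; m≤n⇒m≤1+n; m≤m+n; n≤1+n; +-suc; +-cancelˡ-≤; +-monoˡ-≤; *-monoʳ-≤
        ; suc-injective; <⇒≢; module ≤-Reasoning )
open import Data.Nat.Combinatorics using (nC1≡n; nCk+nC[k+1]≡[n+1]C[k+1])
open import Data.Bool using (true; false)
open import Data.Bool.Properties using (¬-not) renaming (_≟_ to _≟ᵇ_)
open import Data.Fin using (Fin; zero; suc)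
open import Data.Fin.Properties using (any?) renaming (suc-injective to suc-injectiveᶠ)
open import Data.Fin.Subset
  using (Subset; ⁅_⁆; _∪_; _─_; ∣_∣; inside; outside; ⊤; _∈_; _∉_; _⊆_; Nonempty) renaming (⊥ to ∅)
open import Data.Fin.Subset.Properties
  using ( _∈?_; ∈⊤; ∉⊥; ∣⊥∣≡0; ∣⊤∣≡n; ∣p∣≤∣x∷p∣; x∈⁅x⁆; x∈⁅y⁆⇒x≡y; x∈p∪q⁺; x∈p∪q⁻; ∪-identityˡ
        ; ⊆-antisym; p─q⊆p; anySubset? )
open import Data.Vec using ([]; _∷_; lookup; here; there)
open import Data.Vec.Properties using (lookup∘tabulate; []=⇒lookup; lookup⇒[]=)
open import Data.Vec.Functional using () renaming (_∷_ to _∷ᶠ_)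
open import Data.Product using (Σ; ∃; ∃₂; _×_; _,_; proj₁; proj₂)
import Data.Product as Product
open import Data.Sum using (_⊎_; inj₁; inj₂; [_,_]′)
import Data.Sum as Sum
open import Data.Empty using (⊥-elim)
open import Function using (_∘_; id)
open import Function.Definitions using (Injective)
open import Relation.Binary.PropositionalEquality using (_≡_; _≢_; refl; sym; trans; cong; subst)
open import Relation.Nullary using (¬_; Dec; yes; no; ¬?; decidable-stable)
open import Relation.Nullary.Decidable using (_×-dec_)

private
  variable
    n m : ℕ

module _ {A : Set} where

  ∷ᶠ-injective : {x : A} {g : Fin n → A} → (∀ i → g i ≢ x) → Injective _≡_ _≡_ g →
                 Injective _≡_ _≡_ (x ∷ᶠ g)
  ∷ᶠ-injective fresh inj {zero}  {zero}  _  = refl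
  ∷ᶠ-injective fresh inj {zero}  {suc j} eq = ⊥-elim (fresh j (sym eq))
  ∷ᶠ-injective fresh inj {suc i} {zero}  eq = ⊥-elim (fresh i eq)
  ∷ᶠ-injective fresh inj {suc i} {suc j} eq = cong suc (inj eq)

∣p∣>0⇒Nonempty : (p : Subset n) → 0 < ∣ p ∣ → Nonempty p
∣p∣>0⇒Nonempty (inside ∷ p)  _ = zero , here
∣p∣>0⇒Nonempty (outside ∷ p) h = Product.map suc there (∣p∣>0⇒Nonempty p h)

x∈p⇒∣p∣>0 : {x : Fin n} {p : Subset n} → x ∈ p → 0 < ∣ p ∣
x∈p⇒∣p∣>0 here                  = s≤s z≤n
x∈p⇒∣p∣>0 {p = s ∷ p} (there x∈p) = ≤-trans (x∈p⇒∣p∣>0 x∈p) (∣p∣≤∣x∷p∣ s p)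

∣⁅x⁆∪p∣ : {x : Fin n} {p : Subset n} → x ∉ p → ∣ ⁅ x ⁆ ∪ p ∣ ≡ suc ∣ p ∣
∣⁅x⁆∪p∣ {x = zero}  {outside ∷ p} _   = cong (suc ∘ ∣_∣) (∪-identityˡ p)
∣⁅x⁆∪p∣ {x = zero}  {inside ∷ p}  x∉p = ⊥-elim (x∉p here)
∣⁅x⁆∪p∣ {x = suc x} {outside ∷ p} x∉p = ∣⁅x⁆∪p∣ (x∉p ∘ there)
∣⁅x⁆∪p∣ {x = suc x} {inside ∷ p}  x∉p = cong suc (∣⁅x⁆∪p∣ (x∉p ∘ there))

x∈p─q⇒x∉q : {x : Fin n} (p q : Subset n) → x ∈ p ─ q → x ∉ q
x∈p─q⇒x∉q (_ ∷ p) (outside ∷ q) here      ()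
x∈p─q⇒x∉q (_ ∷ p) (_ ∷ q)       (there x∈) (there x∈q) = x∈p─q⇒x∉q p q x∈ x∈q

∣p∣≤∣q∣+∣p─q∣ : (p q : Subset n) → ∣ p ∣ ≤ ∣ q ∣ + ∣ p ─ q ∣
∣p∣≤∣q∣+∣p─q∣ []            []            = z≤n
∣p∣≤∣q∣+∣p─q∣ (outside ∷ p) (outside ∷ q) = ∣p∣≤∣q∣+∣p─q∣ p q
∣p∣≤∣q∣+∣p─q∣ (outside ∷ p) (inside ∷ q)  = m≤n⇒m≤1+n (∣p∣≤∣q∣+∣p─q∣ p q)
∣p∣≤∣q∣+∣p─q∣ (inside ∷ p)  (inside ∷ q)  = s≤s (∣p∣≤∣q∣+∣p─q∣ p q)
∣p∣≤∣q∣+∣p─q∣ (inside ∷ p)  (outside ∷ q) =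
  ≤-trans (s≤s (∣p∣≤∣q∣+∣p─q∣ p q)) (≤-reflexive (sym (+-suc ∣ q ∣ ∣ p ─ q ∣)))

∈-img⁺ : (f : Fin m → Fin n) {e : Subset m} {i : Fin m} → i ∈ e → f i ∈ img f e
∈-img⁺ f {inside ∷ e} here       = x∈p∪q⁺ (inj₁ (x∈⁅x⁆ (f zero)))
∈-img⁺ f {_ ∷ e}      (there i∈e) = x∈p∪q⁺ (inj₂ (∈-img⁺ (f ∘ suc) i∈e))

∈-img⁻ : (f : Fin m → Fin n) (e : Subset m) {y : Fin n} → y ∈ img f e →
         ∃ λ i → i ∈ e × f i ≡ y
∈-img⁻ f [] y∈ = ⊥-elim (∉⊥ y∈)
∈-img⁻ f (inside ∷ e) y∈ with x∈p∪q⁻ ⁅ f zero ⁆ (img (f ∘ suc) e) y∈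
... | inj₁ y∈⁅f0⁆ = zero , here , sym (x∈⁅y⁆⇒x≡y (f zero) y∈⁅f0⁆)
... | inj₂ y∈img  = Product.map suc (Product.map there id) (∈-img⁻ (f ∘ suc) e y∈img)
∈-img⁻ f (outside ∷ e) y∈ with x∈p∪q⁻ ∅ (img (f ∘ suc) e) y∈
... | inj₁ y∈∅   = ⊥-elim (∉⊥ y∈∅)
... | inj₂ y∈img = Product.map suc (Product.map there id) (∈-img⁻ (f ∘ suc) e y∈img)

∣img∣ : {f : Fin m → Fin n} → Injective _≡_ _≡_ f → (e : Subset m) → ∣ img f e ∣ ≡ ∣ e ∣
∣img∣ {n = n} inj [] = ∣⊥∣≡0 n
∣img∣ {f = f} inj (outside ∷ e) =
  trans (cong ∣_∣ (∪-identityˡ (img (f ∘ suc) e))) (∣img∣ (suc-injectiveᶠ ∘ inj) e)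
∣img∣ {f = f} inj (inside ∷ e) =
  trans (∣⁅x⁆∪p∣ f0∉) (cong suc (∣img∣ (suc-injectiveᶠ ∘ inj) e))
  where
  f0∉ : f zero ∉ img (f ∘ suc) e
  f0∉ f0∈ with ∈-img⁻ (f ∘ suc) e f0∈
  ... | _ , _ , eq with inj eq
  ... | ()

img-id : (e : Subset n) → img id e ≡ e
img-id e = ⊆-antisym img⊆e (λ i∈e → ∈-img⁺ id i∈e)
  where
  img⊆e : img id e ⊆ e
  img⊆e y∈ with ∈-img⁻ id e y∈
  ... | _ , i∈e , refl = i∈e

∈-traceOn⁺ : (ι : Fin m → Fin n) {h : Subset n} {i : Fin m} → ι i ∈ h → i ∈ traceOn ι h
∈-traceOn⁺ ι {h} {i} ιi∈h =
  lookup⇒[]= i (traceOn ι h) (trans (lookup∘tabulate (lookup h ∘ ι) i) ([]=⇒lookup ιi∈h))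

∈-traceOn⁻ : (ι : Fin m → Fin n) {h : Subset n} {i : Fin m} → i ∈ traceOn ι h → ι i ∈ h
∈-traceOn⁻ ι {h} {i} i∈tr =
  lookup⇒[]= (ι i) h (trans (sym (lookup∘tabulate (lookup h ∘ ι) i)) ([]=⇒lookup i∈tr))

∣p∣≡1⇒singleton : (p : Subset n) → ∣ p ∣ ≡ 1 → ∃ λ i → i ∈ p × (∀ {j} → j ∈ p → j ≡ i)
∣p∣≡1⇒singleton (inside ∷ p) eq = zero , here , λ
  { here        → refl
  ; (there j∈p) → ⊥-elim (<⇒≢ (x∈p⇒∣p∣>0 j∈p) (sym (suc-injective eq)))
  }
∣p∣≡1⇒singleton (outside ∷ p) eq with ∣p∣≡1⇒singleton p eq
... | i , i∈p , only = suc i , there i∈p , λ { (there j∈p) → cong suc (only j∈p) }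

∣p∣≡2⇒pair : (p : Subset n) → ∣ p ∣ ≡ 2 →
             ∃₂ λ i j → i ≢ j × i ∈ p × j ∈ p × (∀ {k} → k ∈ p → k ≡ i ⊎ k ≡ j)
∣p∣≡2⇒pair (inside ∷ p) eq with ∣p∣≡1⇒singleton p (suc-injective eq)
... | j , j∈p , only = zero , suc j , (λ ()) , here , there j∈p , λ
  { here        → inj₁ refl
  ; (there k∈p) → inj₂ (cong suc (only k∈p))
  }
∣p∣≡2⇒pair (outside ∷ p) eq with ∣p∣≡2⇒pair p eq
... | i , j , i≢j , i∈p , j∈p , only =
  suc i , suc j , i≢j ∘ suc-injectiveᶠ , there i∈p , there j∈p ,
  λ { (there k∈p) → Sum.map (cong suc) (cong suc) (only k∈p) }

module RamseyArgument (k : ℕ) {N : ℕ} (c : Colouring N) where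

  record RedStar (t : ℕ) (W : Subset N) : Set where
    field
      apex           : Fin N
      leaf           : Fin t → Fin N
      leaf-injective : Injective _≡_ _≡_ leaf
      leaf≢apex      : ∀ i → leaf i ≢ apex
      apex∈W         : apex ∈ W
      leaf∈W         : ∀ i → leaf i ∈ W
      red            : ∀ e → ∣ e ∣ ≡ suc k → c (⁅ apex ⁆ ∪ img leaf e) ≡ true

    vertices : Subset N
    vertices = img (apex ∷ᶠ leaf) ⊤

    ∣vertices∣ : ∣ vertices ∣ ≡ suc t
    ∣vertices∣ = trans (∣img∣ (∷ᶠ-injective leaf≢apex leaf-injective) ⊤) (∣⊤∣≡n (suc t))

    ∉vertices : {x : Fin N} → x ∉ vertices → ∀ i → (apex ∷ᶠ leaf) i ≢ x
    ∉vertices x∉ i eq = x∉ (subst (_∈ vertices) eq (∈-img⁺ (apex ∷ᶠ leaf) {i = i} ∈⊤))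

    fresh-leaf-injective : {x : Fin N} → x ∉ vertices → Injective _≡_ _≡_ (x ∷ᶠ leaf)
    fresh-leaf-injective x∉ = ∷ᶠ-injective (∉vertices x∉ ∘ suc) leaf-injective

    fresh-leaf≢apex : {x : Fin N} → x ∉ vertices → ∀ i → (x ∷ᶠ leaf) i ≢ apex
    fresh-leaf≢apex x∉ zero    = ∉vertices x∉ zero ∘ sym
    fresh-leaf≢apex x∉ (suc i) = leaf≢apex i

    apexEdge : Fin N → Subset t → Subset N
    apexEdge x e = img (apex ∷ᶠ (x ∷ᶠ leaf)) (inside ∷ inside ∷ e)

    BlueLinked : Fin N → Set
    BlueLinked x = ∃ λ e → ∣ e ∣ ≡ k × c (apexEdge x e) ≡ false

    blueLinked? : ∀ x → Dec (BlueLinked x)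
    blueLinked? x = anySubset? λ e → (∣ e ∣ ≟ k) ×-dec (c (apexEdge x e) ≟ᵇ false)

  open RedStar

  record Link {s : ℕ} (vertex : Fin s → Fin N) (W : Subset N) (i j : Fin s) : Set where
    field
      edge   : Subset N
      blue   : c edge ≡ false
      size   : ∣ edge ∣ ≡ suc (suc k)
      edge⊆W : edge ⊆ W
      ∋i     : vertex i ∈ edge
      ∋j     : vertex j ∈ edge
      only   : ∀ {l} → vertex l ∈ edge → l ≡ i ⊎ l ≡ j

  record BlueTK (s : ℕ) (W : Subset N) : Set where
    field
      vertex           : Fin s → Fin N
      vertex-injective : Injective _≡_ _≡_ vertex
      vertex∈W         : ∀ i → vertex i ∈ W
      link             : ∀ {i j} → i ≢ j → Link vertex W i j

  open BlueTK

  module _ {s : ℕ} {vertex : Fin s → Fin N} {W : Subset N} {i j : Fin s} where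

    Link-sym : Link vertex W i j → Link vertex W j i
    Link-sym L = record
      { edge = edge ; blue = blue ; size = size ; edge⊆W = edge⊆W
      ; ∋i = ∋j ; ∋j = ∋i ; only = Sum.swap ∘ only }
      where open Link L

    Link-∷ : {u : Fin N} {W′ : Subset N} → W ⊆ W′ → u ∉ W →
             Link vertex W i j → Link (u ∷ᶠ vertex) W′ (suc i) (suc j)
    Link-∷ W⊆W′ u∉W L = record
      { edge = edge ; blue = blue ; size = size ; edge⊆W = W⊆W′ ∘ edge⊆W
      ; ∋i = ∋i ; ∋j = ∋j ; only = only′ }
      where
      open Link L
      only′ : ∀ {l} → (_ ∷ᶠ vertex) l ∈ edge → l ≡ suc i ⊎ l ≡ suc j
      only′ {zero}  u∈      = ⊥-elim (u∉W (edge⊆W u∈))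
      only′ {suc l} vertex∈ = Sum.map (cong suc) (cong suc) (only vertex∈)

  module _ {W : Subset N} where

    singleStar : Nonempty W → RedStar 0 W
    singleStar (x , x∈W) = record
      { apex = x ; leaf = λ () ; leaf-injective = λ { {()} } ; leaf≢apex = λ () ; apex∈W = x∈W
      ; leaf∈W = λ () ; red = λ { [] () } }

    singleTK : Nonempty W → BlueTK 1 W
    singleTK (x , x∈W) = record
      { vertex = λ _ → x ; vertex-injective = λ { {zero} {zero} _ → refl } ; vertex∈W = λ _ → x∈W
      ; link = λ { {zero} {zero} 0≢0 → ⊥-elim (0≢0 refl) } }

  RedStar-weaken : {t : ℕ} {W W′ : Subset N} → W ⊆ W′ → RedStar t W → RedStar t W′
  RedStar-weaken W⊆W′ R = record
    { apex = apex R ; leaf = leaf R ; leaf-injective = leaf-injective R ; leaf≢apex = leaf≢apex R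
    ; apex∈W = W⊆W′ (apex∈W R) ; leaf∈W = W⊆W′ ∘ leaf∈W R ; red = red R }

  module _ {t : ℕ} {W : Subset N} where

    extend : {x : Fin N} (R : RedStar t W) → x ∈ W → x ∉ vertices R → ¬ BlueLinked R x →
             RedStar (suc t) W
    extend {x} R x∈W x∉ unlinked = record
      { apex = apex R ; leaf = x ∷ᶠ leaf R
      ; leaf-injective = fresh-leaf-injective R x∉ ; leaf≢apex = fresh-leaf≢apex R x∉
      ; apex∈W = apex∈W R ; leaf∈W = λ { zero → x∈W ; (suc i) → leaf∈W R i } ; red = red′ }
      where
      red′ : ∀ e → ∣ e ∣ ≡ suc k → c (⁅ apex R ⁆ ∪ img (x ∷ᶠ leaf R) e) ≡ true
      red′ (outside ∷ e) ∣e∣≡a = subst (λ h → c (⁅ apex R ⁆ ∪ h) ≡ true)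
                                       (sym (∪-identityˡ (img (leaf R) e))) (red R e ∣e∣≡a)
      red′ (inside ∷ e)  ∣e∣≡a = ¬-not (unlinked ∘ (e ,_) ∘ (suc-injective ∣e∣≡a ,_))

    attach : {s : ℕ} (R : RedStar t W) → (∀ {x} → x ∈ W ─ vertices R → BlueLinked R x) →
             BlueTK s (W ─ vertices R) → BlueTK (suc s) W
    attach R linked T = record
      { vertex = apex R ∷ᶠ vertex T
      ; vertex-injective =
          ∷ᶠ-injective (λ i eq → apex∉W′ (subst (_∈ W′) eq (vertex∈W T i))) (vertex-injective T)
      ; vertex∈W = λ { zero → apex∈W R ; (suc i) → W′⊆W (vertex∈W T i) }
      ; link = link′ }
      where
      W′ = W ─ vertices R
      W′⊆W = p─q⊆p W (vertices R)
      fresh : ∀ i → vertex T i ∉ vertices R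
      fresh i = x∈p─q⇒x∉q W (vertices R) (vertex∈W T i)
      apex∉W′ : apex R ∉ W′
      apex∉W′ apex∈W′ = ∉vertices R (x∈p─q⇒x∉q W (vertices R) apex∈W′) zero refl

      apexLink : ∀ j → Link (apex R ∷ᶠ vertex T) W zero (suc j)
      apexLink j with linked (vertex∈W T j)
      ... | e , ∣e∣≡k , blue = record
        { edge = apexEdge R x e ; blue = blue ; size = size ; edge⊆W = edge⊆W
        ; ∋i = ∈-img⁺ g {inside ∷ inside ∷ e} here
        ; ∋j = ∈-img⁺ g {inside ∷ inside ∷ e} (there here)
        ; only = only }
        where
        x : Fin N
        x = vertex T j
        g : Fin (suc (suc t)) → Fin N
        g = apex R ∷ᶠ (x ∷ᶠ leaf R)
        size : ∣ apexEdge R x e ∣ ≡ suc (suc k)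
        size = trans (∣img∣ g-injective (inside ∷ inside ∷ e)) (cong (2 +_) ∣e∣≡k)
          where
          g-injective : Injective _≡_ _≡_ g
          g-injective = ∷ᶠ-injective (fresh-leaf≢apex R (fresh j)) (fresh-leaf-injective R (fresh j))
        g∈W : ∀ i → g i ∈ W
        g∈W zero          = apex∈W R
        g∈W (suc zero)    = W′⊆W (vertex∈W T j)
        g∈W (suc (suc i)) = leaf∈W R i
        edge⊆W : apexEdge R x e ⊆ W
        edge⊆W y∈ with ∈-img⁻ g (inside ∷ inside ∷ e) y∈
        ... | i , _ , refl = g∈W i
        only : ∀ {l} → (apex R ∷ᶠ vertex T) l ∈ apexEdge R x e → l ≡ zero ⊎ l ≡ suc j
        only {zero}  _ = inj₁ refl
        only {suc l} vertex∈ with ∈-img⁻ g (inside ∷ inside ∷ e) vertex∈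
        ... | zero , _ , eq          = ⊥-elim (∉vertices R (fresh l) zero eq)
        ... | suc zero , _ , eq      = inj₂ (cong suc (vertex-injective T (sym eq)))
        ... | suc (suc i) , _ , eq   = ⊥-elim (∉vertices R (fresh l) (suc i) eq)

      link′ : ∀ {i j} → i ≢ j → Link (apex R ∷ᶠ vertex T) W i j
      link′ {zero}  {zero}  0≢0 = ⊥-elim (0≢0 refl)
      link′ {zero}  {suc j} _   = apexLink j
      link′ {suc i} {zero}  _   = Link-sym (apexLink i)
      link′ {suc i} {suc j} i≢j = Link-∷ W′⊆W apex∉W′ (link T (i≢j ∘ cong suc))

    grow : {s : ℕ} → RedStar t W → suc (suc s * suc t) ≤ ∣ W ∣ →
           (∀ W′ → suc (s * suc t) ≤ ∣ W′ ∣ → RedStar (suc t) W′ ⊎ BlueTK (suc s) W′) →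
           RedStar (suc t) W ⊎ BlueTK (suc (suc s)) W
    grow {s} R bound arrow′ = decide (any? λ x → (x ∈? W′) ×-dec ¬? (blueLinked? R x))
      where
      W′ = W ─ vertices R
      W′⊆W = p─q⊆p W (vertices R)

      bound′ : suc (s * suc t) ≤ ∣ W′ ∣
      bound′ = +-cancelˡ-≤ (suc t) _ _ (begin
        suc t + suc (s * suc t) ≡⟨ +-suc (suc t) (s * suc t) ⟩
        suc (suc s * suc t)     ≤⟨ bound ⟩
        ∣ W ∣                   ≤⟨ ∣p∣≤∣q∣+∣p─q∣ W (vertices R) ⟩
        ∣ vertices R ∣ + ∣ W′ ∣ ≡⟨ cong (_+ ∣ W′ ∣) (∣vertices∣ R) ⟩
        suc t + ∣ W′ ∣          ∎)
        where open ≤-Reasoning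

      decide : Dec (∃ λ x → x ∈ W′ × ¬ BlueLinked R x) →
               RedStar (suc t) W ⊎ BlueTK (suc (suc s)) W
      decide (yes (x , x∈W′ , unlinked)) =
        inj₁ (extend R (W′⊆W x∈W′) (x∈p─q⇒x∉q W (vertices R) x∈W′) unlinked)
      decide (no none) = Sum.map (RedStar-weaken W′⊆W) (attach R linked) (arrow′ W′ bound′)
        where
        linked : ∀ {x} → x ∈ W′ → BlueLinked R x
        linked {x} x∈W′ = decidable-stable (blueLinked? R x) (none ∘ (x ,_) ∘ (x∈W′ ,_))

  arrow : ∀ t s (W : Subset N) → suc (s * t) ≤ ∣ W ∣ → RedStar t W ⊎ BlueTK (suc s) W
  arrow t       zero    W bound = inj₂ (singleTK (∣p∣>0⇒Nonempty W bound))
  arrow zero    (suc s) W bound = inj₁ (singleStar (∣p∣>0⇒Nonempty W (≤-trans (s≤s z≤n) bound)))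
  arrow (suc t) (suc s) W bound
    with arrow t (suc s) W (≤-trans (s≤s (*-monoʳ-≤ (suc s) (n≤1+n t))) bound)
  ... | inj₁ R = grow R bound (arrow (suc t) s)
  ... | inj₂ T = inj₂ T

  RedStar⇒Contains : {t : ℕ} {W : Subset N} → RedStar t W →
                     Contains c true (Suspension (Complete (suc k) t))
  RedStar⇒Contains R = apex R ∷ᶠ leaf R , ∷ᶠ-injective (leaf≢apex R) (leaf-injective R) ,
    λ { (_ ∷ e) (refl , ∣e∣≡a) → red R e ∣e∣≡a }

  BlueTK⇒Contains : {s : ℕ} {W : Subset N} → BlueTK s W →
                    ∃ λ m → Σ (Hypergraph m) λ H → InTK (suc k) s H × Contains c false H
  BlueTK⇒Contains T =
    N , H ,
    ((λ _ → proj₁ ∘ proj₂) , vertex T , vertex-injective T , (λ _ → proj₂ ∘ proj₂) , cover) ,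
    id , id , λ e He → subst (λ h → c h ≡ false) (sym (img-id e)) (proj₁ He)
    where
    H : Hypergraph N
    H h = c h ≡ false × ∣ h ∣ ≡ suc (suc k) × ∣ traceOn (vertex T) h ∣ ≡ 2

    cover : ∀ p → ∣ p ∣ ≡ 2 → Σ (Subset N) λ h → H h × traceOn (vertex T) h ≡ p
    cover p ∣p∣≡2 with ∣p∣≡2⇒pair p ∣p∣≡2
    ... | i , j , i≢j , i∈p , j∈p , only-p =
      edge , (blue , size , trans (cong ∣_∣ trace≡p) ∣p∣≡2) , trace≡p
      where
      open Link (link T i≢j)
      trace≡p : traceOn (vertex T) edge ≡ p
      trace≡p = ⊆-antisym
        (λ l∈ → [ (λ { refl → i∈p }) , (λ { refl → j∈p }) ]′ (only (∈-traceOn⁻ (vertex T) l∈)))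
        (λ l∈ → ∈-traceOn⁺ (vertex T) {edge}
                  ([ (λ { refl → ∋i }) , (λ { refl → ∋j }) ]′ (only-p l∈)))

ramsey-arrow : ∀ k t s {N} → suc (s * t) ≤ N → RamseyArrow (suc k) t (suc s) N
ramsey-arrow k t s {N} bound c =
  Sum.map RedStar⇒Contains BlueTK⇒Contains
    (arrow t s ⊤ (subst (suc (s * t) ≤_) (sym (∣⊤∣≡n N)) bound))
  where open RamseyArgument k c

1≤[2+n]C2 : ∀ n → 1 ≤ suc (suc n) C 2
1≤[2+n]C2 n = begin
  1                       ≤⟨ s≤s z≤n ⟩
  suc n                   ≡⟨ nC1≡n (suc n) ⟨
  suc n C 1               ≤⟨ m≤m+n (suc n C 1) (suc n C 2) ⟩
  suc n C 1 + suc n C 2   ≡⟨ nCk+nC[k+1]≡[n+1]C[k+1] (suc n) 1 ⟩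
  suc (suc n) C 2         ∎
  where open ≤-Reasoning

corollary4p4 : (a t s : ℕ) → 2 ≤ a → a ≤ t → 2 ≤ s →
    RamseyArrow a t s (t C 2 + (s ∸ 1) * t)
corollary4p4 (suc (suc k)) (suc (suc n)) (suc s) (s≤s (s≤s z≤n)) (s≤s (s≤s _)) (s≤s _) =
  ramsey-arrow (suc k) (suc (suc n)) s (+-monoˡ-≤ (s * suc (suc n)) (1≤[2+n]C2 n))
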